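{- Let $T=(V,E)$ be a tree, let $x$ be a centroid vertex of $T$, let $b$ be a leaf of $T$, let $\bar b$ be the vertex adjacent to $b$, and let $u\neq x$ be an arbitrary vertex of $T$. Let $T_1$ be the branch at $x$ containing $u$, let $T_2$ be the branch at $x$ containing $b$, and let $S=(T\setminus(T_1\cup T_2))\cup\{x\}$ be the union of all other branches at $x$. Let $\overline{T}=(V,(E\setminus\{(\bar b,b)\})\cup\{(u,b)\})$ be the tree obtained from $T$ by removing the edge $(\bar b,b)$ and inserting the edge $(u,b)$ instead. Then: (a) If $T_1=T_2$ or $|T_1|<|T_2|+|S|-1$, then $x$ is a centroid vertex of $\overline{T}$. (b) If $T_1\neq T_2$ and $|T_1|\geq |T_2|+|S|-1$, then the vertex adjacent to $x$ on the shortest path from $x$ to $u$ is a centroid vertex of $\overline{T}$.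
   Context: All graphs are finite, simple, undirected and connected. For a tree $T$ and a vertex $x$, a branch at $x$ is a maximal subtree of $T$ which contains $x$ as a leaf; $|T'|$ denotes the number of vertices of a subtree $T'$ (so a branch $T'$ at $x$ includes $x$), and the weight of a branch $T'$ at $x$ is $|T'|-1$. The branch weight $W_T(x)$ of $x$ is the maximum weight of a branch at $x$. A centroid vertex of $T$ is a vertex of minimum branch weight. A leaf is a vertex of degree $1$. -}

module Defs where

open import Data.Nat using (ℕ; _≤_; _∸_)
open import Data.Fin using (Fin)
open import Data.Fin.Subset using (Subset; _∈_; ∣_∣)
open import Data.List using (List; length; _++_; take; []; _∷_)
open import Data.List.Relation.Unary.Unique.Propositional using (Unique)
open import Data.Product using (Σ; _×_)
open import Data.Sum using (_⊎_)
open import Data.Unit using (⊤)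
open import Relation.Nullary using (¬_)
open import Relation.Binary.PropositionalEquality using (_≡_; _≢_)
open import Relation.Binary.Construct.Closure.ReflexiveTransitive using (Star)
open import Function.Bundles using (_⇔_)

EdgeRel : ℕ → Set₁
EdgeRel n = Fin n → Fin n → Set

module _ {n : ℕ} (E : EdgeRel n) where

  IsWalk : List (Fin n) → Set
  IsWalk [] = ⊤
  IsWalk (p ∷ []) = ⊤
  IsWalk (p ∷ q ∷ r) = E p q × IsWalk (q ∷ r)

  -- a cycle: at least 3 distinct vertices v0 … vk with v_i ~ v_{i+1} and vk ~ v0
  HasCycle : Set
  HasCycle = Σ (List (Fin n)) λ c → (3 ≤ length c) × Unique c × IsWalk (c ++ take 1 c)

  Connected : Set
  Connected = ∀ p q → Star E p q

  IsTree : Set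
  IsTree = (∀ {p q} → E p q → E q p) × (∀ {p} → ¬ E p p) × Connected × ¬ HasCycle

  Avoid : Fin n → EdgeRel n
  Avoid x p q = E p q × p ≢ x × q ≢ x

  IsBranch : Fin n → Fin n → Subset n → Set
  IsBranch x v B = ∀ w → (w ∈ B) ⇔ (w ≡ x ⊎ Star (Avoid x) v w)

  -- every branch at x has weight (= |branch| - 1) at most k, i.e. W(x) ≤ k
  WeightBound : Fin n → ℕ → Set
  WeightBound x k = ∀ v B → v ≢ x → IsBranch x v B → ∣ B ∣ ∸ 1 ≤ k

  -- x is a centroid vertex: W(x) ≤ W(y) for all y
  -- (expressed as: every upper bound of W(y) is an upper bound of W(x))
  Centroid : Fin n → Set
  Centroid x = ∀ y k → WeightBound y k → WeightBound x k

Replace : ∀ {n} → EdgeRel n → (bbar b u : Fin n) → EdgeRel n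
Replace E bbar b u p q =
  (E p q × ¬ ((p ≡ bbar × q ≡ b) ⊎ (p ≡ b × q ≡ bbar)))
  ⊎ ((p ≡ u × q ≡ b) ⊎ (p ≡ b × q ≡ u))

module Submission where

-- The proof rests on the classical characterisation of centroid vertices: in a
-- tree on n vertices, x is a centroid vertex iff it is *balanced*, i.e. every
-- branch B at x satisfies 2|B| ≤ n + 2 (weight at most n/2).

open import Defs
open import Data.Nat using (ℕ; zero; suc; _<_; _≤_; _+_; _∸_; z≤n; s≤s; _≤?_)
open import Data.Nat.Properties
  using (module ≤-Reasoning; ≤-refl; ≤-trans; ≤-reflexive; ≤-antisym; +-assoc; +-identityʳ; +-mono-≤;
         +-monoʳ-≤; +-cancelʳ-≤; +-cancelʳ-<; +-mono-<; <⇒≱; ≰⇒>;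
         <-irrefl; m≤n+m; m≤m+n; ∸-monoˡ-≤; <-≤-trans)
open import Data.Nat.Tactic.RingSolver using (solve-∀)
open import Data.Fin using (Fin; _≟_)
import Data.Fin as Fin
import Data.Vec as Vec
open import Data.Fin.Subset using (Subset; _∈_; _∉_; _⊂_; ∣_∣; ⊤; ⁅_⁆)
open import Data.Fin.Subset.Properties
  using (∈⊤; ∣⊤∣≡n; x∈⁅x⁆; x∈⁅y⁆⇒x≡y; ∣⁅x⁆∣≡1; ⊆-antisym; p⊆q⇒∣p∣≤∣q∣; p⊂q⇒∣p∣<∣q∣; _∈?_)
open import Data.Product using (_×_; Σ; ∃; ∃₂; _,_; proj₁; proj₂)
open import Data.Sum using (_⊎_; inj₁; inj₂)
open import Data.Empty using (⊥; ⊥-elim)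
open import Data.Unit using (tt)
open import Data.Bool using (true; false; if_then_else_) renaming (_≟_ to _≟ᵇ_)
open import Data.List using (List; []; _∷_; length; _++_; foldl; map)
open import Data.Nat.ListAction using (sum)
open import Data.List.Relation.Unary.All using (All; []; _∷_)
open import Data.List.Relation.Unary.All.Properties using (¬Any⇒All¬)
open import Data.List.Relation.Unary.Any using (here; there)
open import Data.List.Relation.Unary.AllPairs using ([]; _∷_)
open import Data.List.Relation.Unary.Unique.Propositional using (Unique)
open import Data.List.Membership.Propositional using () renaming (_∈_ to _∈ₗ_)
import Data.List.Membership.DecPropositional as DecMembership
open import Data.Vec using (lookup; tabulate; tail)
open import Data.Vec.Properties using (lookup∘tabulate; []=⇒lookup; lookup⇒[]=; ≡-dec)
open import Relation.Binary.PropositionalEquality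
  using (_≡_; _≢_; refl; sym; trans; cong; cong₂; subst; subst₂)
open import Relation.Binary.Construct.Closure.ReflexiveTransitive
  using (Star; ε; _◅_; _◅◅_; reverse) renaming (map to mapWalk)
open import Relation.Nullary using (Dec; yes; no; ¬_; does)
open import Relation.Nullary.Decidable using (_⊎-dec_; dec-true)
open import Relation.Unary using (Decidable)
open import Function.Bundles using (_⇔_; mk⇔; Equivalence)

open Equivalence using (to; from)

module _ {n : ℕ} where
  open DecMembership (_≟_ {n}) using () renaming (_∈?_ to _∈ₗ?_)

  Outside : EdgeRel n → (Fin n → Set) → EdgeRel n
  Outside R P p q = R p q × ¬ P p × ¬ P q

  firstEntry : ∀ {R : EdgeRel n} {P : Fin n → Set} → Decidable P → ∀ {a t} →
    Star R a t → P t →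
    P a ⊎ ∃₂ λ z t′ → Star (Outside R P) a z × R z t′ × ¬ P z × P t′
  firstEntry P? ε pt = inj₁ pt
  firstEntry P? (_◅_ {i = a} {j = c} e rest) pt with P? a | P? c
  ... | yes pa | _ = inj₁ pa
  ... | no ¬pa | yes pc = inj₂ (a , c , ε , e , ¬pa , pc)
  ... | no ¬pa | no ¬pc with firstEntry P? rest pt
  ...   | inj₁ pc = ⊥-elim (¬pc pc)
  ...   | inj₂ (z , t′ , s , e′ , ¬pz , pt′) =
          inj₂ (z , t′ , (e , ¬pa , ¬pc) ◅ s , e′ , ¬pz , pt′)

  lastStep : ∀ {R : EdgeRel n} {a} t → Star R a t →
    a ≡ t ⊎ ∃ λ z → Star (Avoid R t) a z × R z t × z ≢ t
  lastStep t s with firstEntry (_≟ t) s refl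
  ... | inj₁ a≡t = inj₁ a≡t
  ... | inj₂ (z , .t , s′ , e , z≢t , refl) = inj₂ (z , s′ , e , z≢t)

  avoidOrReach : ∀ {R : EdgeRel n} x {a w} → w ≢ x → Star R a w →
    Star (Avoid R x) a w ⊎ Star R a x
  avoidOrReach x w≢x ε = inj₁ ε
  avoidOrReach x w≢x (_◅_ {i = a} {j = c} e rest) with a ≟ x | c ≟ x
  ... | yes refl | _ = inj₂ ε
  ... | no a≢x | yes refl = inj₂ (e ◅ ε)
  ... | no a≢x | no c≢x with avoidOrReach x w≢x rest
  ...   | inj₁ s = inj₁ ((e , a≢x , c≢x) ◅ s)
  ...   | inj₂ s = inj₂ (e ◅ s)

  forgetAvoid : ∀ {R : EdgeRel n} {x y a w} → Star (Avoid (Avoid R y) x) a w → Star (Avoid R x) a w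
  forgetAvoid = mapWalk λ { ((e , _ , _) , p≢x , q≢x) → e , p≢x , q≢x }

  reverseAvoidWith : ∀ {R : EdgeRel n} → (∀ {p q} → R p q → R q p) →
    ∀ {x a w} → Star (Avoid R x) a w → Star (Avoid R x) w a
  reverseAvoidWith symR = reverse λ (e , p≢x , q≢x) → symR e , q≢x , p≢x

  firstOfTwo : ∀ {R : EdgeRel n} x y → x ≢ y → ∀ {a} → Star R a x →
    a ≡ x ⊎ a ≡ y ⊎ Star (Avoid R y) a x ⊎ Star (Avoid R x) a y
  firstOfTwo x y x≢y s with firstEntry (λ t → (t ≟ x) ⊎-dec (t ≟ y)) s (inj₁ refl)
  ... | inj₁ (inj₁ a≡x) = inj₁ a≡x
  ... | inj₁ (inj₂ a≡y) = inj₂ (inj₁ a≡y)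
  ... | inj₂ (z , .x , s′ , e , z∉ , inj₁ refl) =
        inj₂ (inj₂ (inj₁ (mapWalk (λ (g , p , q) → g , (λ h → p (inj₂ h)) , (λ h → q (inj₂ h))) s′
                          ◅◅ ((e , (λ h → z∉ (inj₂ h)) , x≢y) ◅ ε))))
  ... | inj₂ (z , .y , s′ , e , z∉ , inj₂ refl) =
        inj₂ (inj₂ (inj₂ (mapWalk (λ (g , p , q) → g , (λ h → p (inj₁ h)) , (λ h → q (inj₁ h))) s′
                          ◅◅ ((e , (λ h → z∉ (inj₁ h)) , (λ h → x≢y (sym h))) ◅ ε))))

  -- If b has no neighbour other than c in a symmetric relation R, a walk between
  -- two vertices other than b can skip b: each visit to b has the form c–b–c.
  module LeafBypass {R : EdgeRel n} {b c : Fin n} (symR : ∀ {p q} → R p q → R q p)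
                    (onlyC : ∀ {w} → R b w → w ≡ c) where
    mutual
      bypass : ∀ {a w} → a ≢ b → w ≢ b → Star R a w → Star (Avoid R b) a w
      bypass a≢b w≢b ε = ε
      bypass a≢b w≢b (_◅_ {j = a₁} e rest) with a₁ ≟ b
      ... | no a₁≢b = (e , a≢b , a₁≢b) ◅ bypass a₁≢b w≢b rest
      ... | yes refl = bypassVisit a≢b w≢b e rest

      bypassVisit : ∀ {a w} → a ≢ b → w ≢ b → R a b → Star R b w → Star (Avoid R b) a w
      bypassVisit a≢b w≢b e ε = ⊥-elim (w≢b refl)
      bypassVisit {a} a≢b w≢b e (_◅_ {j = a₂} e₂ rest) =
        subst (λ t → Star (Avoid R b) t _) a₂≡a (bypass (λ h → a≢b (trans (sym a₂≡a) h)) w≢b rest)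
        where a₂≡a : a₂ ≡ a
              a₂≡a = trans (onlyC e₂) (sym (onlyC (symR e)))

  data Path (R : EdgeRel n) : Fin n → Fin n → List (Fin n) → Set where
    stop : ∀ {a} → Path R a a (a ∷ [])
    step : ∀ {a b c L} → R a b → Path R b c L → Path R a c (a ∷ L)

  suffixFrom : ∀ {R : EdgeRel n} {a b c L} → Path R b c L → a ∈ₗ L → Unique L →
    Σ (List (Fin n)) λ L′ → Path R a c L′ × Unique L′
  suffixFrom stop (here refl) u = _ , stop , u
  suffixFrom (step e p) (here refl) u = _ , step e p , u
  suffixFrom (step e p) (there m) (_ ∷ u) = suffixFrom p m u

  loopErase : ∀ {R : EdgeRel n} {a c} → Star R a c →
    Σ (List (Fin n)) λ L → Path R a c L × Unique L
  loopErase ε = _ , stop , ([] ∷ [])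
  loopErase {a = a} (e ◅ rest) with loopErase rest
  ... | L , p , u with a ∈ₗ? L
  ...   | yes m = suffixFrom p m u
  ...   | no a∉L = a ∷ L , step e p , (¬Any⇒All¬ L a∉L ∷ u)

  -- In a tree, two distinct neighbours y, z of x are never joined by a walk
  -- avoiding x: its loop erasure preceded by x would be a cycle.
  noDetour : ∀ {G : EdgeRel n} → IsTree G →
    ∀ {x y z} → G x y → G x z → y ≢ z → ¬ Star (Avoid G x) y z
  noDetour {G} (symG , irreflG , _ , acyclic) {x} {y} {z} exy exz y≢z s with loopErase s
  ... | _ , stop , _ = y≢z refl
  ... | _ , step {L = L} e p , unique =
        acyclic (x ∷ y ∷ L , s≤s (s≤s (nonEmpty p)) , (avoids (step e p) z≢x ∷ unique) ,
                 exy , closes (step e p) (symG exz))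
    where
      z≢x : z ≢ x
      z≢x z≡x = irreflG (subst (G x) z≡x exz)
      avoids : ∀ {a c K} → Path (Avoid G x) a c K → c ≢ x → All (x ≢_) K
      avoids stop c≢x = (λ h → c≢x (sym h)) ∷ []
      avoids (step (_ , a≢x , _) q) c≢x = (λ h → a≢x (sym h)) ∷ avoids q c≢x
      closes : ∀ {a c t K} → Path (Avoid G x) a c K → G c t → IsWalk G (K ++ t ∷ [])
      closes stop ect = ect , tt
      closes (step e stop) ect = proj₁ e , ect , tt
      closes (step e q@(step _ _)) ect = proj₁ e , closes q ect
      nonEmpty : ∀ {R : EdgeRel n} {a c K} → Path R a c K → 1 ≤ length K
      nonEmpty stop = s≤s z≤n
      nonEmpty (step _ _) = s≤s z≤n

  record TreeLike (G : EdgeRel n) : Set where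
    field
      symmetric : ∀ {p q} → G p q → G q p
      irreflexive : ∀ {p} → ¬ G p p
      connected : Connected G
      separated : ∀ {x y z} → G x y → G x z → y ≢ z → ¬ Star (Avoid G x) y z

  isTree⇒treeLike : ∀ {G : EdgeRel n} → IsTree G → TreeLike G
  isTree⇒treeLike tree@(symG , irreflG , conn , _) = record
    { symmetric = symG ; irreflexive = irreflG ; connected = conn ; separated = noDetour tree }

  branch⁻ : ∀ {G : EdgeRel n} {x v B w} → IsBranch G x v B → w ∈ B → w ≡ x ⊎ Star (Avoid G x) v w
  branch⁻ isB = to (isB _)

  branch⁺ : ∀ {G : EdgeRel n} {x v B w} → IsBranch G x v B → w ≡ x ⊎ Star (Avoid G x) v w → w ∈ B
  branch⁺ isB = from (isB _)

  subsetOf : ∀ {P : Fin n → Set} → Decidable P → Subset n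
  subsetOf P? = tabulate (λ w → does (P? w))

  ∈subsetOf : ∀ {P : Fin n → Set} (P? : Decidable P) w → (w ∈ subsetOf P?) ⇔ P w
  ∈subsetOf P? w = mk⇔ (λ m → witness (P? w) (trans (sym (lookup∘tabulate _ w)) ([]=⇒lookup m)))
                       (λ p → lookup⇒[]= w _ (trans (lookup∘tabulate _ w) (dec-true (P? w) p)))
    where witness : ∀ {A : Set} (d : Dec A) → does d ≡ true → A
          witness (yes a) _ = a

  module TreeLikeFacts {G : EdgeRel n} (tl : TreeLike G) where
    open TreeLike tl

    reverseAvoid : ∀ {x a w} → Star (Avoid G x) a w → Star (Avoid G x) w a
    reverseAvoid = reverseAvoidWith symmetric

    stuckFrom : ∀ {y w} → Star (Avoid G y) y w → w ≡ y
    stuckFrom ε = refl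
    stuckFrom ((_ , y≢y , _) ◅ _) = ⊥-elim (y≢y refl)

    stuckTo : ∀ {y a} → Star (Avoid G y) a y → a ≡ y
    stuckTo s = stuckFrom (reverseAvoid s)

    -- Reachability in G - y is decidable: a and w are joined iff their last
    -- steps towards y arrive from the same neighbour of y.
    reachable? : ∀ y a w → Dec (Star (Avoid G y) a w)
    reachable? y a w with a ≟ y | w ≟ y
    ... | yes refl | yes refl = yes ε
    ... | yes refl | no w≢y = no λ s → w≢y (stuckFrom s)
    ... | no a≢y | yes refl = no λ s → a≢y (stuckTo s)
    ... | no a≢y | no w≢y with lastStep y (connected a y) | lastStep y (connected w y)
    ...   | inj₁ a≡y | _ = ⊥-elim (a≢y a≡y)
    ...   | inj₂ _ | inj₁ w≡y = ⊥-elim (w≢y w≡y)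
    ...   | inj₂ (z₁ , s₁ , e₁ , _) | inj₂ (z₂ , s₂ , e₂ , _) with z₁ ≟ z₂
    ...     | yes refl = yes (s₁ ◅◅ reverseAvoid s₂)
    ...     | no z₁≢z₂ =
              no λ s → separated (symmetric e₁) (symmetric e₂) z₁≢z₂ (reverseAvoid s₁ ◅◅ s ◅◅ s₂)

    sides : ∀ {x y w} → G x y → Star (Avoid G x) y w → ¬ Star (Avoid G y) w x
    sides {x} exy s₁ s₂ with lastStep x s₂
    ... | inj₁ refl = irreflexive (subst (G x) (stuckTo s₁) exy)
    ... | inj₂ (z , s , (ezx , z≢y , _) , _) =
          separated exy (symmetric ezx) (λ h → z≢y (sym h)) (s₁ ◅◅ forgetAvoid s)

    branchesMeet : ∀ {x v v′ B B′ w} → IsBranch G x v B → IsBranch G x v′ B′ →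
      w ∈ B → w ∈ B′ → w ≢ x → B ≡ B′
    branchesMeet {x} {v} {v′} {B} {B′} {w} isB isB′ w∈B w∈B′ w≢x = ⊆-antisym (λ {z} → B⊆B′ z) (λ {z} → B′⊆B z)
      where
        away : ∀ {c C} → IsBranch G x c C → w ∈ C → Star (Avoid G x) c w
        away isC w∈C with branch⁻ isC w∈C
        ... | inj₁ w≡x = ⊥-elim (w≢x w≡x)
        ... | inj₂ s = s
        B⊆B′ : ∀ z → z ∈ B → z ∈ B′
        B⊆B′ z z∈B with branch⁻ isB z∈B
        ... | inj₁ z≡x = branch⁺ isB′ (inj₁ z≡x)
        ... | inj₂ v⇝z = branch⁺ isB′ (inj₂ (away isB′ w∈B′ ◅◅ reverseAvoid (away isB w∈B) ◅◅ v⇝z))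
        B′⊆B : ∀ z → z ∈ B′ → z ∈ B
        B′⊆B z z∈B′ with branch⁻ isB′ z∈B′
        ... | inj₁ z≡x = branch⁺ isB (inj₁ z≡x)
        ... | inj₂ v′⇝z = branch⁺ isB (inj₂ (away isB w∈B ◅◅ reverseAvoid (away isB′ w∈B′) ◅◅ v′⇝z))

    branchAt : ∀ x v → Σ (Subset n) (IsBranch G x v)
    branchAt x v = subsetOf member? , ∈subsetOf member?
      where member? : ∀ w → Dec (w ≡ x ⊎ Star (Avoid G x) v w)
            member? w = (w ≟ x) ⊎-dec reachable? x v w

ind : ∀ {n} → Subset n → Fin n → ℕ
ind p i = if lookup p i then 1 else 0

-- For a list of subsets: the number of them containing i, and the sum of their
-- sizes.  Both are summed from the left, so that total (p ∷ q ∷ []) is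
-- literally ∣ p ∣ + ∣ q ∣.
hits : ∀ {n} → List (Subset n) → Fin n → ℕ
hits ps i = foldl (λ s p → s + ind p i) 0 ps

total : ∀ {n} → List (Subset n) → ℕ
total ps = foldl (λ s p → s + ∣ p ∣) 0 ps

private
  interchange : ∀ a b c d → (a + b) + (c + d) ≡ (a + c) + (b + d)
  interchange = solve-∀

  foldl-sum : ∀ {A : Set} (f : A → ℕ) a xs → foldl (λ s x → s + f x) a xs ≡ a + sum (map f xs)
  foldl-sum f a [] = sym (+-identityʳ a)
  foldl-sum f a (x ∷ xs) = trans (foldl-sum f (a + f x) xs) (+-assoc a (f x) _)

  size-∷ : ∀ {n} b (p : Subset n) → ∣ b Vec.∷ p ∣ ≡ ind (b Vec.∷ p) Fin.zero + ∣ p ∣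
  size-∷ true p = refl
  size-∷ false p = refl

  sizes-suc : ∀ {n} (ps : List (Subset (suc n))) →
    sum (map ∣_∣ ps) ≡ sum (map (λ p → ind p Fin.zero) ps) + sum (map ∣_∣ (map tail ps))
  sizes-suc [] = refl
  sizes-suc ((b Vec.∷ p) ∷ ps) =
    trans (cong₂ _+_ (size-∷ b p) (sizes-suc ps)) (interchange (ind (b Vec.∷ p) Fin.zero) ∣ p ∣ _ _)

  hits-tail : ∀ {n} (ps : List (Subset (suc n))) i →
    sum (map (λ p → ind p (Fin.suc i)) ps) ≡ sum (map (λ p → ind p i) (map tail ps))
  hits-tail [] i = refl
  hits-tail ((b Vec.∷ p) ∷ ps) i = cong (ind p i +_) (hits-tail ps i)

  sizes-zero : (ps : List (Subset 0)) → sum (map ∣_∣ ps) ≡ 0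
  sizes-zero [] = refl
  sizes-zero (Vec.[] ∷ ps) = sizes-zero ps

  sizes-≤ : ∀ {n} (ps qs : List (Subset n)) →
    (∀ i → sum (map (λ p → ind p i) ps) ≤ sum (map (λ q → ind q i) qs)) →
    sum (map ∣_∣ ps) ≤ sum (map ∣_∣ qs)
  sizes-≤ {zero} ps qs _ = ≤-reflexive (trans (sizes-zero ps) (sym (sizes-zero qs)))
  sizes-≤ {suc n} ps qs h = subst₂ _≤_ (sym (sizes-suc ps)) (sym (sizes-suc qs))
    (+-mono-≤ (h Fin.zero) (sizes-≤ (map tail ps) (map tail qs) λ i →
      subst₂ _≤_ (hits-tail ps i) (hits-tail qs i) (h (Fin.suc i))))

count-≤ : ∀ {n} (ps qs : List (Subset n)) → (∀ i → hits ps i ≤ hits qs i) → total ps ≤ total qs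
count-≤ ps qs h = subst₂ _≤_ (sym (foldl-sum ∣_∣ 0 ps)) (sym (foldl-sum ∣_∣ 0 qs))
  (sizes-≤ ps qs λ i → subst₂ _≤_ (foldl-sum _ 0 ps) (foldl-sum _ 0 qs) (h i))

count-≡ : ∀ {n} (ps qs : List (Subset n)) → (∀ i → hits ps i ≡ hits qs i) → total ps ≡ total qs
count-≡ ps qs h = ≤-antisym (count-≤ ps qs (λ i → ≤-reflexive (h i)))
                            (count-≤ qs ps (λ i → ≤-reflexive (sym (h i))))

full+2 : ∀ {n} (x y : Fin n) → ∣ ⊤ {n} ∣ + ∣ ⁅ x ⁆ ∣ + ∣ ⁅ y ⁆ ∣ ≡ n + 2
full+2 {n} x y = trans (cong₂ _+_ (cong₂ _+_ (∣⊤∣≡n n) (∣⁅x⁆∣≡1 x)) (∣⁅x⁆∣≡1 y)) (+-assoc n 1 1)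

ind-∈ : ∀ {n} {p : Subset n} {i} → i ∈ p → ind p i ≡ 1
ind-∈ m = cong (λ b → if b then 1 else 0) ([]=⇒lookup m)

ind-∉ : ∀ {n} {p : Subset n} {i} → i ∉ p → ind p i ≡ 0
ind-∉ {p = p} {i} i∉p with lookup p i in eq
... | true = ⊥-elim (i∉p (lookup⇒[]= i p eq))
... | false = refl

ind-≤1 : ∀ {n} (p : Subset n) i → ind p i ≤ 1
ind-≤1 p i with lookup p i
... | true = ≤-refl
... | false = z≤n

ind-mono : ∀ {n} {p q : Subset n} i → (i ∈ p → i ∈ q) → ind p i ≤ ind q i
ind-mono {p = p} i p⇒q with i ∈? p
... | yes m = ≤-reflexive (trans (ind-∈ m) (sym (ind-∈ (p⇒q m))))
... | no i∉p = subst (_≤ _) (sym (ind-∉ i∉p)) z≤n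

ind-⊤ : ∀ {n} (i : Fin n) → ind ⊤ i ≡ 1
ind-⊤ {n} i = ind-∈ {p = ⊤ {n}} ∈⊤

ind-⁅⁆ : ∀ {n} (x : Fin n) → ind ⁅ x ⁆ x ≡ 1
ind-⁅⁆ x = ind-∈ (x∈⁅x⁆ x)

ind-⁅⁆≢ : ∀ {n} {x i : Fin n} → i ≢ x → ind ⁅ x ⁆ i ≡ 0
ind-⁅⁆≢ {x = x} i≢x = ind-∉ (λ m → i≢x (x∈⁅y⁆⇒x≡y x m))

halve : ∀ a c → a + a ≤ c + c → a ≤ c
halve a c h with a ≤? c
... | yes a≤c = a≤c
... | no a≰c = ⊥-elim (<⇒≱ (+-mono-< (≰⇒> a≰c) (≰⇒> a≰c)) h)

doubled : ∀ {a c N} → a ≤ c → c + c ≤ N → a + a ≤ N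
doubled a≤c h = ≤-trans (+-mono-≤ a≤c a≤c) h

belowComplement : ∀ B C D N → D + D ≤ N → B + B ≤ N → N ≤ C + D → B ≤ C
belowComplement B C D N hD hB cover = halve B C (≤-trans hB (≤-trans cover (+-monoʳ-≤ C D≤C)))
  where D≤C = +-cancelʳ-≤ D D C (≤-trans hD cover)

smallerThanHeavy : ∀ B C N → C + B ≤ N + 2 → ¬ (B + B ≤ N + 2) → suc C ≤ B
smallerThanHeavy B C N h heavy = +-cancelʳ-< B C B (<-≤-trans (s≤s h) (≰⇒> heavy))

heavyWeight : ∀ m k → ¬ (m + m ≤ k + 2) → ¬ (m ∸ 1 ≤ m ∸ 2)
heavyWeight zero k heavy _ = heavy z≤n
heavyWeight (suc zero) k heavy _ = heavy (m≤n+m 2 k)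
heavyWeight (suc (suc m)) k heavy h = <-irrefl refl h

<∸1⇒2+≤ : ∀ a c → a < c ∸ 1 → 2 + a ≤ c
<∸1⇒2+≤ a (suc c) h = s≤s h

∸1≤⇒≤1+ : ∀ c t → c ∸ 1 ≤ t → c ≤ suc t
∸1≤⇒≤1+ zero t h = z≤n
∸1≤⇒≤1+ (suc c) t h = s≤s h

boundA : ∀ B T U N → B ≤ T + 1 → T < U ∸ 1 → T + U ≤ N → B + B ≤ N
boundA B T U N B≤T+1 T<U∸1 T+U≤N = begin
  B + B             ≤⟨ +-mono-≤ B≤T+1 B≤T+1 ⟩
  (T + 1) + (T + 1) ≡⟨ regroup T ⟩
  T + (2 + T)       ≤⟨ +-monoʳ-≤ T (<∸1⇒2+≤ T U T<U∸1) ⟩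
  T + U             ≤⟨ T+U≤N ⟩
  N                 ∎
  where
    open ≤-Reasoning
    regroup : ∀ t → (t + 1) + (t + 1) ≡ t + (2 + t)
    regroup = solve-∀

boundB : ∀ B T U N → B + T + 1 ≤ N → T + U ≡ N → U ∸ 1 ≤ T → B + B ≤ N
boundB B T U N B+T+1≤N T+U≡N U∸1≤T = ≤-trans (m≤m+n (B + B) 1) (+-cancelʳ-≤ N (B + B + 1) N (begin
  B + B + 1 + N             ≤⟨ +-monoʳ-≤ (B + B + 1) N≤T+1+T ⟩
  B + B + 1 + (T + (1 + T)) ≡⟨ regroup B T ⟩
  (B + T + 1) + (B + T + 1) ≤⟨ +-mono-≤ B+T+1≤N B+T+1≤N ⟩
  N + N                     ∎))
  where
    open ≤-Reasoning
    N≤T+1+T : N ≤ T + (1 + T)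
    N≤T+1+T = subst (_≤ T + (1 + T)) T+U≡N (+-monoʳ-≤ T (∸1≤⇒≤1+ U T U∸1≤T))
    regroup : ∀ b t → b + b + 1 + (t + (1 + t)) ≡ (b + t + 1) + (b + t + 1)
    regroup = solve-∀

-- x is balanced when every branch B at x has weight at most n/2: 2|B| ≤ n + 2.
Balanced : ∀ {n} → EdgeRel n → Fin n → Set
Balanced {n} G x = ∀ v B → v ≢ x → IsBranch G x v B → ∣ B ∣ + ∣ B ∣ ≤ n + 2

module Criterion {n : ℕ} {G : EdgeRel n} (tl : TreeLike G) where
  open TreeLike tl
  open TreeLikeFacts tl

  -- For distinct x, y: the branch C at y containing x and the branch D at x
  -- containing y cover all vertices, and both contain x and y.
  opposingBranches : ∀ {x y C D} → x ≢ y → IsBranch G y x C → IsBranch G x y D →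
    n + 2 ≤ ∣ C ∣ + ∣ D ∣
  opposingBranches {x} {y} {C} {D} x≢y isC isD =
    subst (_≤ ∣ C ∣ + ∣ D ∣) (full+2 x y) (count-≤ (⊤ ∷ ⁅ x ⁆ ∷ ⁅ y ⁆ ∷ []) (C ∷ D ∷ []) pointwise)
    where
      cover : ∀ w → w ∈ C ⊎ w ∈ D
      cover w with firstOfTwo x y x≢y (connected w x)
      ... | inj₁ w≡x = inj₂ (branch⁺ isD (inj₁ w≡x))
      ... | inj₂ (inj₁ w≡y) = inj₁ (branch⁺ isC (inj₁ w≡y))
      ... | inj₂ (inj₂ (inj₁ s)) = inj₁ (branch⁺ isC (inj₂ (reverseAvoid s)))
      ... | inj₂ (inj₂ (inj₂ s)) = inj₂ (branch⁺ isD (inj₂ (reverseAvoid s)))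
      pointwise : ∀ i → ind ⊤ i + ind ⁅ x ⁆ i + ind ⁅ y ⁆ i ≤ ind C i + ind D i
      pointwise i rewrite ind-⊤ i with i ≟ x | i ≟ y
      ... | yes refl | _ rewrite ind-⁅⁆ x | ind-⁅⁆≢ x≢y
                               | ind-∈ (branch⁺ isC (inj₂ ε)) | ind-∈ (branch⁺ isD (inj₁ refl)) = ≤-refl
      ... | no i≢x | yes refl rewrite ind-⁅⁆ y | ind-⁅⁆≢ i≢x
                               | ind-∈ (branch⁺ isC (inj₁ refl)) | ind-∈ (branch⁺ isD (inj₂ ε)) = ≤-refl
      ... | no i≢x | no i≢y rewrite ind-⁅⁆≢ i≢x | ind-⁅⁆≢ i≢y with cover i
      ...   | inj₁ i∈C rewrite ind-∈ i∈C = s≤s z≤n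
      ...   | inj₂ i∈D rewrite ind-∈ i∈D = m≤n+m 1 (ind C i)

  -- A balanced vertex is a centroid vertex: a branch B at x is no larger than
  -- the branch at any other y that contains x.
  balanced⇒centroid : ∀ {x} → Balanced G x → Centroid G x
  balanced⇒centroid {x} bal y k y-bound v B v≢x isB with y ≟ x
  ... | yes refl = y-bound v B v≢x isB
  ... | no y≢x = ≤-trans (∸-monoˡ-≤ 1 B≤C) (y-bound x C x≢y isC)
    where
      x≢y : x ≢ y
      x≢y x≡y = y≢x (sym x≡y)
      C = proj₁ (branchAt y x)
      isC = proj₂ (branchAt y x)
      D = proj₁ (branchAt x y)
      isD = proj₂ (branchAt x y)
      B≤C : ∣ B ∣ ≤ ∣ C ∣
      B≤C = belowComplement (∣ B ∣) (∣ C ∣) (∣ D ∣) (n + 2) (bal y D y≢x isD) (bal v B v≢x isB)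
                            (opposingBranches x≢y isC isD)

  -- Let y be a neighbour of x in the branch B at x containing v.  A branch C at
  -- y containing x meets B only in x and y, so |C| + |B| ≤ n + 2.
  acrossEdge : ∀ {x y v B w C} → G y x → Star (Avoid G x) v y → IsBranch G x v B →
    IsBranch G y w C → x ∈ C → ∣ C ∣ + ∣ B ∣ ≤ n + 2
  acrossEdge {x} {y} {v} {B} {w} {C} eyx v⇝y isB isC x∈C =
    subst (∣ C ∣ + ∣ B ∣ ≤_) (full+2 x y) (count-≤ (C ∷ B ∷ []) (⊤ ∷ ⁅ x ⁆ ∷ ⁅ y ⁆ ∷ []) pointwise)
    where
      y≢x : y ≢ x
      y≢x y≡x = irreflexive (subst (λ t → G t x) y≡x eyx)
      x≢y : x ≢ y
      x≢y x≡y = y≢x (sym x≡y)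
      w⇝x : Star (Avoid G y) w x
      w⇝x with branch⁻ isC x∈C
      ... | inj₁ x≡y = ⊥-elim (x≢y x≡y)
      ... | inj₂ s = s
      notBoth : ∀ {i} → i ≢ x → i ≢ y → i ∈ C → i ∈ B → ⊥
      notBoth i≢x i≢y i∈C i∈B with branch⁻ isC i∈C | branch⁻ isB i∈B
      ... | inj₁ i≡y | _ = i≢y i≡y
      ... | _ | inj₁ i≡x = i≢x i≡x
      ... | inj₂ w⇝i | inj₂ v⇝i =
            sides (symmetric eyx) (reverseAvoid v⇝y ◅◅ v⇝i) (reverseAvoid (reverseAvoid w⇝x ◅◅ w⇝i))
      pointwise : ∀ i → ind C i + ind B i ≤ ind ⊤ i + ind ⁅ x ⁆ i + ind ⁅ y ⁆ i
      pointwise i rewrite ind-⊤ i with i ≟ x | i ≟ y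
      ... | yes refl | _ rewrite ind-⁅⁆ x | ind-⁅⁆≢ x≢y
                               | ind-∈ x∈C | ind-∈ (branch⁺ isB (inj₁ refl)) = ≤-refl
      ... | no i≢x | yes refl rewrite ind-⁅⁆ y | ind-⁅⁆≢ i≢x
                               | ind-∈ (branch⁺ isC (inj₁ refl)) | ind-∈ (branch⁺ isB (inj₂ v⇝y)) = ≤-refl
      ... | no i≢x | no i≢y rewrite ind-⁅⁆≢ i≢x | ind-⁅⁆≢ i≢y with i ∈? C | i ∈? B
      ...   | no i∉C | _ rewrite ind-∉ i∉C = ind-≤1 B i
      ...   | yes i∈C | no i∉B rewrite ind-∈ i∈C | ind-∉ i∉B = ≤-refl
      ...   | yes i∈C | yes i∈B = ⊥-elim (notBoth i≢x i≢y i∈C i∈B)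

  sameSide : ∀ {x y v B w C} → G y x → Star (Avoid G x) v y → IsBranch G x v B →
    w ≢ y → IsBranch G y w C → x ∉ C → C ⊂ B
  sameSide {x} {y} {v} {B} {w} {C} eyx v⇝y isB w≢y isC x∉C =
    (λ {i} → inside i) , x , branch⁺ isB (inj₁ refl) , x∉C
    where
      x≢y : x ≢ y
      x≢y x≡y = irreflexive (subst (G y) x≡y eyx)
      w⇝y : Star (Avoid G x) w y
      w⇝y with firstOfTwo x y x≢y (connected w x)
      ... | inj₁ refl = ⊥-elim (x∉C (branch⁺ isC (inj₂ ε)))
      ... | inj₂ (inj₁ w≡y) = ⊥-elim (w≢y w≡y)
      ... | inj₂ (inj₂ (inj₁ s)) = ⊥-elim (x∉C (branch⁺ isC (inj₂ s)))
      ... | inj₂ (inj₂ (inj₂ s)) = s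
      inside : ∀ i → i ∈ C → i ∈ B
      inside i i∈C with branch⁻ isC i∈C | i ≟ x
      ... | inj₁ refl | _ = branch⁺ isB (inj₂ v⇝y)
      ... | inj₂ _ | yes refl = ⊥-elim (x∉C i∈C)
      ... | inj₂ w⇝i | no i≢x with avoidOrReach x i≢x w⇝i
      ...   | inj₂ w⇝x = ⊥-elim (x∉C (branch⁺ isC (inj₂ w⇝x)))
      ...   | inj₁ s = branch⁺ isB (inj₂ (v⇝y ◅◅ reverseAvoid w⇝y ◅◅ forgetAvoid s))

  -- A centroid vertex is balanced: if a branch B at x had 2|B| > n + 2, the
  -- neighbour y of x in B would have all branch weights at most |B| - 2 < W(x).
  centroid⇒balanced : ∀ {x} → Centroid G x → Balanced G x
  centroid⇒balanced {x} centroid v B v≢x isB with ∣ B ∣ + ∣ B ∣ ≤? n + 2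
  ... | yes balanced = balanced
  ... | no heavy with lastStep x (connected v x)
  ...   | inj₁ v≡x = ⊥-elim (v≢x v≡x)
  ...   | inj₂ (y , v⇝y , eyx , _) =
          ⊥-elim (heavyWeight (∣ B ∣) n heavy (centroid y (∣ B ∣ ∸ 2) y-bound v B v≢x isB))
    where
      y-bound : WeightBound G y (∣ B ∣ ∸ 2)
      y-bound w C w≢y isC with x ∈? C
      ... | yes x∈C = ∸-monoˡ-≤ 2 (smallerThanHeavy (∣ B ∣) (∣ C ∣) n (acrossEdge eyx v⇝y isB isC x∈C) heavy)
      ... | no x∉C = ∸-monoˡ-≤ 2 (p⊂q⇒∣p∣<∣q∣ (sameSide eyx v⇝y isB w≢y isC x∉C))

module MoveLeaf {n : ℕ} {E : EdgeRel n} (tl : TreeLike E) {b bbar u : Fin n}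
                (leaf : ∀ w → E b w → w ≡ bbar) (u≢b : u ≢ b) where
  open TreeLike tl

  T̄ : EdgeRel n
  T̄ = Replace E bbar b u

  symmetricT̄ : ∀ {p q} → T̄ p q → T̄ q p
  symmetricT̄ (inj₁ (e , notOld)) =
    inj₁ (symmetric e , λ { (inj₁ (p , q)) → notOld (inj₂ (q , p)) ; (inj₂ (p , q)) → notOld (inj₁ (q , p)) })
  symmetricT̄ (inj₂ (inj₁ (p , q))) = inj₂ (inj₂ (q , p))
  symmetricT̄ (inj₂ (inj₂ (p , q))) = inj₂ (inj₁ (q , p))

  irreflexiveT̄ : ∀ {p} → ¬ T̄ p p
  irreflexiveT̄ (inj₁ (e , _)) = irreflexive e
  irreflexiveT̄ (inj₂ (inj₁ (p≡u , p≡b))) = u≢b (trans (sym p≡u) p≡b)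
  irreflexiveT̄ (inj₂ (inj₂ (p≡b , p≡u))) = u≢b (trans (sym p≡u) p≡b)

  onlyU : ∀ {w} → T̄ b w → w ≡ u
  onlyU (inj₁ (e , notOld)) = ⊥-elim (notOld (inj₂ (refl , leaf _ e)))
  onlyU (inj₂ (inj₁ (b≡u , _))) = ⊥-elim (u≢b (sym b≡u))
  onlyU (inj₂ (inj₂ (_ , w≡u))) = w≡u

  old : ∀ {p q} → T̄ p q → p ≢ b → q ≢ b → E p q
  old (inj₁ (e , _)) _ _ = e
  old (inj₂ (inj₁ (_ , q≡b))) _ q≢b = ⊥-elim (q≢b q≡b)
  old (inj₂ (inj₂ (p≡b , _))) p≢b _ = ⊥-elim (p≢b p≡b)

  new : ∀ {p q} → E p q → p ≢ b → q ≢ b → T̄ p q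
  new e p≢b q≢b = inj₁ (e , λ { (inj₁ (_ , q≡b)) → q≢b q≡b ; (inj₂ (p≡b , _)) → p≢b p≡b })

  -- Walks of T̄ - z between vertices other than b are walks of T - z, since
  -- the leaf b can be bypassed.
  toOld : ∀ {z a w} → a ≢ b → w ≢ b → Star (Avoid T̄ z) a w → Star (Avoid E z) a w
  toOld a≢b w≢b s = mapWalk (λ ((e , p≢z , q≢z) , p≢b , q≢b) → old e p≢b q≢b , p≢z , q≢z)
    (LeafBypass.bypass (λ (e , p≢z , q≢z) → symmetricT̄ e , q≢z , p≢z) (λ e → onlyU (proj₁ e)) a≢b w≢b s)

  fromOld : ∀ {p q} → p ≢ b → q ≢ b → Star T̄ p q
  fromOld p≢b q≢b = mapWalk (λ (e , p≢ , q≢) → new e p≢ q≢)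
    (LeafBypass.bypass symmetric (λ {w} → leaf w) p≢b q≢b (connected _ _))

  connectedT̄ : Connected T̄
  connectedT̄ p q with p ≟ b | q ≟ b
  ... | yes refl | yes refl = ε
  ... | yes refl | no q≢b = inj₂ (inj₂ (refl , refl)) ◅ fromOld u≢b q≢b
  ... | no p≢b | yes refl = fromOld p≢b u≢b ◅◅ (inj₂ (inj₁ (refl , refl)) ◅ ε)
  ... | no p≢b | no q≢b = fromOld p≢b q≢b

  isolated : ∀ {x z} → x ≡ u → z ≢ b → ¬ Star (Avoid T̄ x) b z
  isolated x≡u z≢b ε = z≢b refl
  isolated x≡u z≢b ((e , _ , c≢x) ◅ _) = c≢x (trans (onlyU e) (sym x≡u))

  separatedT̄ : ∀ {x y z} → T̄ x y → T̄ x z → y ≢ z → ¬ Star (Avoid T̄ x) y z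
  separatedT̄ {x} {y} {z} exy exz y≢z s with x ≟ b | y ≟ b | z ≟ b
  ... | yes refl | _ | _ = y≢z (trans (onlyU exy) (sym (onlyU exz)))
  ... | no x≢b | yes refl | _ = isolated (onlyU (symmetricT̄ exy)) (λ z≡b → y≢z (sym z≡b)) s
  ... | no x≢b | no y≢b | yes refl = isolated (onlyU (symmetricT̄ exz)) y≢b (reverseAvoidWith symmetricT̄ s)
  ... | no x≢b | no y≢b | no z≢b = separated (old exy x≢b y≢b) (old exz x≢b z≢b) y≢z (toOld y≢b z≢b s)

  treeLikeT̄ : TreeLike T̄
  treeLikeT̄ = record
    { symmetric = symmetricT̄ ; irreflexive = irreflexiveT̄ ; connected = connectedT̄ ; separated = separatedT̄ }

  leaveB : ∀ {z w} → w ≢ b → Star (Avoid T̄ z) b w → Star (Avoid T̄ z) u w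
  leaveB w≢b ε = ⊥-elim (w≢b refl)
  leaveB w≢b (e ◅ rest) = subst (λ t → Star _ t _) (onlyU (proj₁ e)) rest

  enterB : ∀ {z a} → a ≢ b → Star (Avoid T̄ z) a b → Star (Avoid T̄ z) a u
  enterB a≢b s = reverseAvoidWith symmetricT̄ (leaveB a≢b (reverseAvoidWith symmetricT̄ s))

module Proposition1 {n : ℕ} {E : EdgeRel n} (tl : TreeLike E) {x b bbar u : Fin n}
  (x-centroid : Centroid E x) (leaf : ∀ w → E b w → w ≡ bbar)
  (b≢x : b ≢ x) (u≢x : u ≢ x) (u≢b : u ≢ b) {T₁ T₂ S : Subset n}
  (isT₁ : IsBranch E x u T₁) (isT₂ : IsBranch E x b T₂)
  (isS : ∀ w → (w ∈ S) ⇔ (w ≡ x ⊎ (w ∉ T₁ × w ∉ T₂))) where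

  open TreeLike tl
  open TreeLikeFacts tl
  open MoveLeaf tl leaf u≢b
  open Criterion using (balanced⇒centroid; centroid⇒balanced)

  x-balanced : Balanced E x
  x-balanced = centroid⇒balanced tl x-centroid

  x≢b : x ≢ b
  x≢b x≡b = b≢x (sym x≡b)

  x∈T₁ : x ∈ T₁
  x∈T₁ = branch⁺ isT₁ (inj₁ refl)

  b∈T₂ : b ∈ T₂
  b∈T₂ = branch⁺ isT₂ (inj₂ ε)

  -- If T₁ ≠ T₂, the sets T₁, T₂, S together cover every vertex once, except x,
  -- which lies in all three.
  partition : T₁ ≢ T₂ → ∣ T₁ ∣ + ∣ T₂ ∣ + ∣ S ∣ ≡ n + 2
  partition T₁≢T₂ = trans (count-≡ (T₁ ∷ T₂ ∷ S ∷ []) (⊤ ∷ ⁅ x ⁆ ∷ ⁅ x ⁆ ∷ []) pointwise) (full+2 x x)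
    where
      notInS : ∀ {i} → i ≢ x → i ∈ T₁ ⊎ i ∈ T₂ → i ∉ S
      notInS i≢x i∈T i∈S with to (isS _) i∈S | i∈T
      ... | inj₁ i≡x | _ = i≢x i≡x
      ... | inj₂ (i∉T₁ , _) | inj₁ i∈T₁ = i∉T₁ i∈T₁
      ... | inj₂ (_ , i∉T₂) | inj₂ i∈T₂ = i∉T₂ i∈T₂
      pointwise : ∀ i → ind T₁ i + ind T₂ i + ind S i ≡ ind ⊤ i + ind ⁅ x ⁆ i + ind ⁅ x ⁆ i
      pointwise i rewrite ind-⊤ i with i ≟ x
      ... | yes refl rewrite ind-∈ x∈T₁ | ind-∈ (branch⁺ isT₂ (inj₁ refl))
                           | ind-∈ (from (isS x) (inj₁ refl)) | ind-⁅⁆ x = refl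
      ... | no i≢x rewrite ind-⁅⁆≢ i≢x with i ∈? T₁ | i ∈? T₂
      ...   | yes i∈T₁ | yes i∈T₂ = ⊥-elim (T₁≢T₂ (branchesMeet isT₁ isT₂ i∈T₁ i∈T₂ i≢x))
      ...   | yes i∈T₁ | no i∉T₂ rewrite ind-∈ i∈T₁ | ind-∉ i∉T₂ | ind-∉ (notInS i≢x (inj₁ i∈T₁)) = refl
      ...   | no i∉T₁ | yes i∈T₂ rewrite ind-∉ i∉T₁ | ind-∈ i∈T₂ | ind-∉ (notInS i≢x (inj₂ i∈T₂)) = refl
      ...   | no i∉T₁ | no i∉T₂ rewrite ind-∉ i∉T₁ | ind-∉ i∉T₂ | ind-∈ (from (isS i) (inj₂ (i∉T₁ , i∉T₂))) = refl

  reachedFromU : ∀ {v w} → Star (Avoid E x) u v → w ≡ x ⊎ Star (Avoid E x) v w → w ∈ T₁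
  reachedFromU u⇝v (inj₁ w≡x) = branch⁺ isT₁ (inj₁ w≡x)
  reachedFromU u⇝v (inj₂ v⇝w) = branch⁺ isT₁ (inj₂ (u⇝v ◅◅ v⇝w))

  -- Let B be a branch of T̄ at x whose vertices other than b lie in
  -- the branch of T at x containing v, and which contains b only if u reaches v
  -- around x.  Then 2|B| ≤ n + 2: either B lies in a branch of T at x, or
  -- B ⊆ T₁ ∪ {b} with |T₁| small enough.
  boundedA : (T₁ ≡ T₂ ⊎ ∣ T₁ ∣ < ∣ T₂ ∣ + ∣ S ∣ ∸ 1) → ∀ B v → v ≢ x →
    (∀ w → w ≢ b → w ∈ B → w ≡ x ⊎ Star (Avoid E x) v w) →
    (b ∈ B → Star (Avoid E x) u v) → ∣ B ∣ + ∣ B ∣ ≤ n + 2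
  boundedA hyp B v v≢x old-side b-side with reachable? x u v
  ... | no u↛v = doubled (p⊆q⇒∣p∣≤∣q∣ (λ {w} → B⊆V w)) (x-balanced v V v≢x isV)
    where
      V = proj₁ (branchAt x v)
      isV = proj₂ (branchAt x v)
      B⊆V : ∀ w → w ∈ B → w ∈ V
      B⊆V w w∈B with w ≟ b
      ... | yes refl = ⊥-elim (u↛v (b-side w∈B))
      ... | no w≢b = branch⁺ isV (old-side w w≢b w∈B)
  ... | yes u⇝v with ≡-dec _≟ᵇ_ T₁ T₂ | hyp
  ...   | yes T₁≡T₂ | _ = doubled (p⊆q⇒∣p∣≤∣q∣ (λ {w} → B⊆T₁ w)) (x-balanced u T₁ u≢x isT₁)
    where
      B⊆T₁ : ∀ w → w ∈ B → w ∈ T₁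
      B⊆T₁ w w∈B with w ≟ b
      ... | yes refl = subst (b ∈_) (sym T₁≡T₂) b∈T₂
      ... | no w≢b = reachedFromU u⇝v (old-side w w≢b w∈B)
  ...   | no T₁≢T₂ | inj₁ T₁≡T₂ = ⊥-elim (T₁≢T₂ T₁≡T₂)
  ...   | no T₁≢T₂ | inj₂ T₁-small =
          boundA (∣ B ∣) (∣ T₁ ∣) (∣ T₂ ∣ + ∣ S ∣) (n + 2) B≤T₁+1 T₁-small
                 (≤-reflexive (trans (sym (+-assoc (∣ T₁ ∣) (∣ T₂ ∣) (∣ S ∣))) (partition T₁≢T₂)))
    where
      pointwise : ∀ i → ind B i ≤ ind T₁ i + ind ⁅ b ⁆ i
      pointwise i with i ≟ b
      ... | yes refl rewrite ind-⁅⁆ b = ≤-trans (ind-≤1 B b) (m≤n+m 1 _)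
      ... | no i≢b rewrite ind-⁅⁆≢ i≢b | +-identityʳ (ind T₁ i) =
            ind-mono i (λ i∈B → reachedFromU u⇝v (old-side i i≢b i∈B))
      B≤T₁+1 : ∣ B ∣ ≤ ∣ T₁ ∣ + 1
      B≤T₁+1 = subst (∣ B ∣ ≤_) (cong (∣ T₁ ∣ +_) (∣⁅x⁆∣≡1 b))
                     (count-≤ (B ∷ []) (T₁ ∷ ⁅ b ⁆ ∷ []) pointwise)

  -- Part (a): every branch of T̄ at x is controlled as in boundedA, through the
  -- branch of T at x containing its starting vertex (u, if it starts at b).
  partA : (T₁ ≡ T₂ ⊎ ∣ T₁ ∣ < ∣ T₂ ∣ + ∣ S ∣ ∸ 1) → Centroid T̄ x
  partA hyp = balanced⇒centroid treeLikeT̄ balanced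
    where
      balanced : Balanced T̄ x
      balanced v B v≢x isB with v ≟ b
      ... | yes refl = boundedA hyp B u u≢x old-side (λ _ → ε)
        where
          old-side : ∀ w → w ≢ b → w ∈ B → w ≡ x ⊎ Star (Avoid E x) u w
          old-side w w≢b w∈B with branch⁻ isB w∈B
          ... | inj₁ w≡x = inj₁ w≡x
          ... | inj₂ b⇝w = inj₂ (toOld u≢b w≢b (leaveB w≢b b⇝w))
      ... | no v≢b = boundedA hyp B v v≢x old-side b-side
        where
          old-side : ∀ w → w ≢ b → w ∈ B → w ≡ x ⊎ Star (Avoid E x) v w
          old-side w w≢b w∈B with branch⁻ isB w∈B
          ... | inj₁ w≡x = inj₁ w≡x
          ... | inj₂ v⇝w = inj₂ (toOld v≢b w≢b v⇝w)
          b-side : b ∈ B → Star (Avoid E x) u v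
          b-side b∈B with branch⁻ isB b∈B
          ... | inj₁ b≡x = ⊥-elim (b≢x b≡x)
          ... | inj₂ v⇝b = reverseAvoid (toOld v≢b u≢b (enterB v≢b v⇝b))

  module PartB (T₁≢T₂ : T₁ ≢ T₂) (T₁-large : ∣ T₂ ∣ + ∣ S ∣ ∸ 1 ≤ ∣ T₁ ∣)
               {y : Fin n} (exy : E x y) (y∈T₁ : y ∈ T₁) where

    y≢x : y ≢ x
    y≢x y≡x = irreflexive (subst (E x) y≡x exy)

    x≢y : x ≢ y
    x≢y x≡y = y≢x (sym x≡y)

    u⇝y : Star (Avoid E x) u y
    u⇝y with branch⁻ isT₁ y∈T₁
    ... | inj₁ y≡x = ⊥-elim (y≢x y≡x)
    ... | inj₂ s = s

    b∉T₁ : b ∉ T₁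
    b∉T₁ b∈T₁ = T₁≢T₂ (branchesMeet isT₁ isT₂ b∈T₁ b∈T₂ b≢x)

    y≢b : y ≢ b
    y≢b y≡b = b∉T₁ (subst (_∈ T₁) y≡b y∈T₁)

    -- A branch B of T̄ at y containing x meets T₁ only in x and y and misses b,
    -- so |B| + |T₁| + 1 ≤ n + 2; with |T₁| ≥ (n + 1)/2 this bounds |B|.
    throughX : ∀ {v B} → IsBranch T̄ y v B → x ∈ B → ∣ B ∣ + ∣ B ∣ ≤ n + 2
    throughX {v} {B} isB x∈B =
      boundB (∣ B ∣) (∣ T₁ ∣) (∣ T₂ ∣ + ∣ S ∣) (n + 2) counted
             (trans (sym (+-assoc (∣ T₁ ∣) (∣ T₂ ∣) (∣ S ∣))) (partition T₁≢T₂)) T₁-large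
      where
        x⇝ : ∀ {i} → Star (Avoid T̄ y) v i → Star (Avoid T̄ y) x i
        x⇝ v⇝i with branch⁻ isB x∈B
        ... | inj₁ x≡y = ⊥-elim (x≢y x≡y)
        ... | inj₂ v⇝x = reverseAvoidWith symmetricT̄ v⇝x ◅◅ v⇝i
        b∉B : b ∉ B
        b∉B b∈B with branch⁻ isB b∈B
        ... | inj₁ b≡y = y≢b (sym b≡y)
        ... | inj₂ v⇝b =
              sides exy (reverseAvoid u⇝y) (reverseAvoid (toOld x≢b u≢b (enterB x≢b (x⇝ v⇝b))))
        notBoth : ∀ {i} → i ≢ x → i ≢ y → i ≢ b → i ∈ B → i ∈ T₁ → ⊥
        notBoth i≢x i≢y i≢b i∈B i∈T₁ with branch⁻ isB i∈B | branch⁻ isT₁ i∈T₁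
        ... | inj₁ i≡y | _ = i≢y i≡y
        ... | _ | inj₁ i≡x = i≢x i≡x
        ... | inj₂ v⇝i | inj₂ u⇝i = sides exy (reverseAvoid u⇝y ◅◅ u⇝i) (reverseAvoid (toOld x≢b i≢b (x⇝ v⇝i)))
        pointwise : ∀ i → ind B i + ind T₁ i + ind ⁅ b ⁆ i ≤ ind ⊤ i + ind ⁅ x ⁆ i + ind ⁅ y ⁆ i
        pointwise i rewrite ind-⊤ i with i ≟ x | i ≟ y | i ≟ b
        ... | yes refl | _ | _ rewrite ind-∈ x∈B | ind-∈ x∈T₁ | ind-⁅⁆≢ x≢b | ind-⁅⁆ x | ind-⁅⁆≢ x≢y = ≤-refl
        ... | no i≢x | yes refl | _ rewrite ind-∈ (branch⁺ isB (inj₁ refl)) | ind-∈ y∈T₁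
                                          | ind-⁅⁆≢ y≢b | ind-⁅⁆≢ y≢x | ind-⁅⁆ y = ≤-refl
        ... | no i≢x | no i≢y | yes refl rewrite ind-∉ b∉B | ind-∉ b∉T₁ | ind-⁅⁆ b
                                               | ind-⁅⁆≢ b≢x | ind-⁅⁆≢ i≢y = ≤-refl
        ... | no i≢x | no i≢y | no i≢b rewrite ind-⁅⁆≢ i≢x | ind-⁅⁆≢ i≢y | ind-⁅⁆≢ i≢b with i ∈? B
        ...   | no i∉B rewrite ind-∉ i∉B = ≤-trans (≤-reflexive (+-identityʳ _)) (ind-≤1 T₁ i)
        ...   | yes i∈B with i ∈? T₁
        ...     | yes i∈T₁ = ⊥-elim (notBoth i≢x i≢y i≢b i∈B i∈T₁)
        ...     | no i∉T₁ rewrite ind-∈ i∈B | ind-∉ i∉T₁ = ≤-refl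
        counted : ∣ B ∣ + ∣ T₁ ∣ + 1 ≤ n + 2
        counted = subst₂ _≤_ (cong (∣ B ∣ + ∣ T₁ ∣ +_) (∣⁅x⁆∣≡1 b)) (full+2 x y)
                         (count-≤ (B ∷ T₁ ∷ ⁅ b ⁆ ∷ []) (⊤ ∷ ⁅ x ⁆ ∷ ⁅ y ⁆ ∷ []) pointwise)

    -- A branch B of T̄ at y not containing x lies in T₁ ∪ {b} and misses x ∈ T₁,
    -- so |B| ≤ |T₁|, which is at most half since x is balanced in T.
    awayFromX : ∀ {v B} → IsBranch T̄ y v B → x ∉ B → ∣ B ∣ + ∣ B ∣ ≤ n + 2
    awayFromX {v} {B} isB x∉B = doubled B≤T₁ (x-balanced u T₁ u≢x isT₁)
      where
        inT₁ : ∀ i → i ≢ x → i ≢ b → i ∈ B → i ∈ T₁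
        inT₁ i i≢x i≢b i∈B with branch⁻ isB i∈B
        ... | inj₁ refl = y∈T₁
        ... | inj₂ v⇝i with firstOfTwo x y x≢y (connectedT̄ i x)
        ...   | inj₁ i≡x = ⊥-elim (i≢x i≡x)
        ...   | inj₂ (inj₁ refl) = y∈T₁
        ...   | inj₂ (inj₂ (inj₁ i⇝x)) = ⊥-elim (x∉B (branch⁺ isB (inj₂ (v⇝i ◅◅ i⇝x))))
        ...   | inj₂ (inj₂ (inj₂ i⇝y)) = branch⁺ isT₁ (inj₂ (u⇝y ◅◅ reverseAvoid (toOld i≢b y≢b i⇝y)))
        pointwise : ∀ i → ind B i + ind ⁅ x ⁆ i ≤ ind T₁ i + ind ⁅ b ⁆ i
        pointwise i with i ≟ x | i ≟ b
        ... | yes refl | _ rewrite ind-∉ x∉B | ind-⁅⁆ x | ind-∈ x∈T₁ | ind-⁅⁆≢ x≢b = ≤-refl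
        ... | no i≢x | yes refl rewrite ind-⁅⁆≢ b≢x | ind-⁅⁆ b =
              ≤-trans (≤-reflexive (+-identityʳ _)) (≤-trans (ind-≤1 B b) (m≤n+m 1 _))
        ... | no i≢x | no i≢b rewrite ind-⁅⁆≢ i≢x | ind-⁅⁆≢ i≢b
                                    | +-identityʳ (ind B i) | +-identityʳ (ind T₁ i) =
              ind-mono i (inT₁ i i≢x i≢b)
        B≤T₁ : ∣ B ∣ ≤ ∣ T₁ ∣
        B≤T₁ = +-cancelʳ-≤ 1 (∣ B ∣) (∣ T₁ ∣)
                 (subst₂ _≤_ (cong (∣ B ∣ +_) (∣⁅x⁆∣≡1 x)) (cong (∣ T₁ ∣ +_) (∣⁅x⁆∣≡1 b))
                         (count-≤ (B ∷ ⁅ x ⁆ ∷ []) (T₁ ∷ ⁅ b ⁆ ∷ []) pointwise))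

    y-centroid : Centroid T̄ y
    y-centroid = balanced⇒centroid treeLikeT̄ λ v B _ isB → bound isB (x ∈? B)
      where
        bound : ∀ {v B} → IsBranch T̄ y v B → Dec (x ∈ B) → ∣ B ∣ + ∣ B ∣ ≤ n + 2
        bound isB (yes x∈B) = throughX isB x∈B
        bound isB (no x∉B) = awayFromX isB x∉B

  partB : (T₁ ≢ T₂ × ∣ T₂ ∣ + ∣ S ∣ ∸ 1 ≤ ∣ T₁ ∣) → ∀ y → E x y → y ∈ T₁ → Centroid T̄ y
  partB (T₁≢T₂ , T₁-large) y exy y∈T₁ = PartB.y-centroid T₁≢T₂ T₁-large exy y∈T₁

proposition1 : ∀ {n : ℕ} (E : EdgeRel n) → IsTree E →
    (x b bbar u : Fin n) →
    Centroid E x →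
    E b bbar → (∀ w → E b w → w ≡ bbar) →
    b ≢ x → u ≢ x → u ≢ b →
    (T₁ T₂ S : Subset n) →
    IsBranch E x u T₁ → IsBranch E x b T₂ →
    (∀ w → (w ∈ S) ⇔ (w ≡ x ⊎ (w ∉ T₁ × w ∉ T₂))) →
    ((T₁ ≡ T₂ ⊎ ∣ T₁ ∣ < ∣ T₂ ∣ + ∣ S ∣ ∸ 1) → Centroid (Replace E bbar b u) x)
    × ((T₁ ≢ T₂ × ∣ T₂ ∣ + ∣ S ∣ ∸ 1 ≤ ∣ T₁ ∣) →
       ∀ y → E x y → y ∈ T₁ → Centroid (Replace E bbar b u) y)
proposition1 E tree x b bbar u x-centroid _ leaf b≢x u≢x u≢b T₁ T₂ S isT₁ isT₂ isS =
  partA , partB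
  where open Proposition1 (isTree⇒treeLike tree) x-centroid leaf b≢x u≢x u≢b isT₁ isT₂ isS
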